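{- (Derived rule Seq-Matched.) For all binary relations $R,S,T$ on IMP states and all IMP commands $c,c',d,d'$: if $\vdash\langle R\rangle\ c,\ c'\ \langle S\rangle$ and $\vdash\langle S\rangle\ d,\ d'\ \langle T\rangle$ are derivable, then $\vdash\langle R\rangle\ (c;d),\ (c';d')\ \langle T\rangle$ is derivable.
   Context: IMP commands: $c ::= x := e \mid c;c \mid \mathbf{if}\ b\ \mathbf{then}\ c\ \mathbf{else}\ c \mid \mathbf{while}\ b\ \mathbf{do}\ c \mid \mathbf{skip}$, where $x$ ranges over program variables, $e$ over integer arithmetic expressions and $b$ over boolean expressions. A state $s$ maps variables to integers; $[e]_s$, $[b]_s$ denote evaluation in $s$, and $s(x:=v)$ is $s$ updated at $x$. $(c,s)\Rightarrow t$ is the standard big-step semantics of IMP. Relations are binary relations on states. Notation: $R\land S$, $R\lor S$ pointwise; $b^1 \equiv \lambda s\,s'.\,[b]_s$; $\exists n.R(n)\equiv\lambda s\,s'.\,\exists n.\,R(n)(s,s')$; $R\implies S$ means $R\subseteq S$; $\overleftrightarrow{R}\equiv\lambda s\,s'.\,R(s',s)$; $R[x:=e]\equiv \lambda s\,s'.\ \exists v.\ R(s(x:=v),s')\land s(x)=[e]_{s(x:=v)}$. The judgement $\vdash\langle R\rangle\ c,\ c'\ \langle S\rangle$ is inductively defined by the rules: (Skip) if $\forall t\,t'.\ S(t,t')\implies\exists s'.\ R(t,s')\land (c',s')\Rightarrow t'$ then $\vdash\langle R\rangle\ \mathbf{skip},\ c'\ \langle S\rangle$; (Seq1) from $\vdash\langle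 R\rangle\ c,\ c'\ \langle S\rangle$ and $\vdash\langle S\rangle\ d,\ \mathbf{skip}\ \langle T\rangle$ infer $\vdash\langle R\rangle\ (c;d),\ c'\ \langle T\rangle$; (Assign) from $\vdash\langle R[x:=e]\rangle\ \mathbf{skip},\ c'\ \langle S\rangle$ infer $\vdash\langle R\rangle\ x:=e,\ c'\ \langle S\rangle$; (IfTrue) from $\vdash\langle R\land b^1\rangle\ c_1,\ c'\ \langle S\rangle$ infer $\vdash\langle R\rangle\ \mathbf{if}\ b\ \mathbf{then}\ c_1\ \mathbf{else}\ c_2,\ c'\ \langle S\rangle$; (IfFalse) from $\vdash\langle R\land (\lnot b)^1\rangle\ c_2,\ c'\ \langle S\rangle$ infer the same conclusion; (WhileFalse) from $\vdash\langle R\land(\lnot b)^1\rangle\ \mathbf{skip},\ c'\ \langle S\rangle$ infer $\vdash\langle R\rangle\ \mathbf{while}\ b\ \mathbf{do}\ c,\ c'\ \langle S\rangle$; (WhileTrue) from $\vdash\langle R\land b^1\rangle\ (c;\mathbf{while}\ b\ \mathbf{do}\ c),\ c'\ \langle S\rangle$ infer $\vdash\langle R\rangle\ \mathbf{while}\ b\ \mathbf{do}\ c,\ c'\ \langle S\rangle$; (Back-Var) from $\forall n.\ \vdash\langle R(n)\land b^1\rangle\ c,\ \mathbf{skip}\ \langle R(n+1)\rangle$ and $\vdash\langle \exists n.R(n)\rangle\ \mathbf{while}\ b\ \mathbf{do}\ c,\ c'\ \langle S\rangle$ infer $\vdash\langle R(0)\rangle\ \mathbf{while}\ b\ \mathbf{do}\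 c,\ c'\ \langle S\rangle$; (Conseq) from $R_1\implies R_2$, $\vdash\langle R_1\rangle\ c,\ c'\ \langle S_1\rangle$ and $S_2\implies S_1$ infer $\vdash\langle R_2\rangle\ c,\ c'\ \langle S_2\rangle$; (Disj) from $\vdash\langle R_1\rangle\ c,\ c'\ \langle S_1\rangle$ and $\vdash\langle R_2\rangle\ c,\ c'\ \langle S_2\rangle$ infer $\vdash\langle R_1\lor R_2\rangle\ c,\ c'\ \langle S_1\lor S_2\rangle$; (Sym) from $\vdash\langle \overleftrightarrow{R}\rangle\ c',\ c\ \langle \overleftrightarrow{S}\rangle$ infer $\vdash\langle R\rangle\ c,\ c'\ \langle S\rangle$. -}

module Defs where

open import Data.Nat using (ℕ; suc; _≟_)
open import Data.Integer using (ℤ) renaming (_+_ to _+ℤ_; _-_ to _-ℤ_; _*_ to _*ℤ_; _≤ᵇ_ to _≤ᵇℤ_)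
open import Data.Bool using (Bool; true; false; not; _∧_)
open import Data.Product using (Σ; ∃; _×_; _,_)
open import Data.Sum using (_⊎_)
open import Relation.Nullary using (yes; no)
open import Relation.Binary.PropositionalEquality using (_≡_)

Var : Set
Var = ℕ

State : Set
State = Var → ℤ

data AExp : Set where
  N    : ℤ → AExp
  V    : Var → AExp
  Plus  : AExp → AExp → AExp
  Minus : AExp → AExp → AExp
  Times : AExp → AExp → AExp

data BExp : Set where
  Bc   : Bool → BExp
  Not  : BExp → BExp
  And  : BExp → BExp → BExp
  Less : AExp → AExp → BExp

aval : AExp → State → ℤ
aval (N n) s = n
aval (V x) s = s x
aval (Plus a b) s = aval a s +ℤ aval b s
aval (Minus a b) s = aval a s -ℤ aval b s
aval (Times a b) s = aval a s *ℤ aval b s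

bval : BExp → State → Bool
bval (Bc v) s = v
bval (Not b) s = not (bval b s)
bval (And b₁ b₂) s = bval b₁ s ∧ bval b₂ s
bval (Less a₁ a₂) s = aval a₁ s ≤ᵇℤ aval a₂ s

data Com : Set where
  SKIP   : Com
  _::=_  : Var → AExp → Com
  _⨾_   : Com → Com → Com
  IF_THEN_ELSE_ : BExp → Com → Com → Com
  WHILE_DO_ : BExp → Com → Com

infixr 5 _⨾_

upd : State → Var → ℤ → State
upd s x v y with y ≟ x
... | yes _ = v
... | no  _ = s y

data ⟨_,_⟩⇒_ : Com → State → State → Set where
  Skip      : ∀ {s} → ⟨ SKIP , s ⟩⇒ s
  Assign    : ∀ {x a s} → ⟨ x ::= a , s ⟩⇒ upd s x (aval a s)
  Seq       : ∀ {c₁ c₂ s₁ s₂ s₃} → ⟨ c₁ , s₁ ⟩⇒ s₂ → ⟨ c₂ , s₂ ⟩⇒ s₃ → ⟨ c₁ ⨾ c₂ , s₁ ⟩⇒ s₃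
  IfTrue    : ∀ {b c₁ c₂ s t} → bval b s ≡ true → ⟨ c₁ , s ⟩⇒ t → ⟨ IF b THEN c₁ ELSE c₂ , s ⟩⇒ t
  IfFalse   : ∀ {b c₁ c₂ s t} → bval b s ≡ false → ⟨ c₂ , s ⟩⇒ t → ⟨ IF b THEN c₁ ELSE c₂ , s ⟩⇒ t
  WhileFalse : ∀ {b c s} → bval b s ≡ false → ⟨ WHILE b DO c , s ⟩⇒ s
  WhileTrue : ∀ {b c s₁ s₂ s₃} → bval b s₁ ≡ true → ⟨ c , s₁ ⟩⇒ s₂ →
              ⟨ WHILE b DO c , s₂ ⟩⇒ s₃ → ⟨ WHILE b DO c , s₁ ⟩⇒ s₃

Rel : Set₁
Rel = State → State → Set

_∧ᴿ_ : Rel → Rel → Rel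
(R ∧ᴿ S) s s' = R s s' × S s s'

_∨ᴿ_ : Rel → Rel → Rel
(R ∨ᴿ S) s s' = R s s' ⊎ S s s'

_¹ : BExp → Rel
(b ¹) s s' = bval b s ≡ true

∃ᴿ : (ℕ → Rel) → Rel
∃ᴿ R s s' = ∃ λ n → R n s s'

_⟹_ : Rel → Rel → Set
R ⟹ S = ∀ s s' → R s s' → S s s'

flipᴿ : Rel → Rel
flipᴿ R s s' = R s' s

_[_≔_] : Rel → Var → AExp → Rel
(R [ x ≔ e ]) s s' = ∃ λ v → R (upd s x v) s' × (s x ≡ aval e (upd s x v))

data ⊢⟨_⟩_,_⟨_⟩ : Rel → Com → Com → Rel → Set₁ where
  skipR : ∀ {R c' S} →
    (∀ t t' → S t t' → ∃ λ s' → R t s' × ⟨ c' , s' ⟩⇒ t') →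
    ⊢⟨ R ⟩ SKIP , c' ⟨ S ⟩
  seq1R : ∀ {R S T c d c'} →
    ⊢⟨ R ⟩ c , c' ⟨ S ⟩ → ⊢⟨ S ⟩ d , SKIP ⟨ T ⟩ → ⊢⟨ R ⟩ (c ⨾ d) , c' ⟨ T ⟩
  assignR : ∀ {R S x e c'} →
    ⊢⟨ R [ x ≔ e ] ⟩ SKIP , c' ⟨ S ⟩ → ⊢⟨ R ⟩ (x ::= e) , c' ⟨ S ⟩
  ifTrueR : ∀ {R S b c₁ c₂ c'} →
    ⊢⟨ R ∧ᴿ (b ¹) ⟩ c₁ , c' ⟨ S ⟩ → ⊢⟨ R ⟩ (IF b THEN c₁ ELSE c₂) , c' ⟨ S ⟩
  ifFalseR : ∀ {R S b c₁ c₂ c'} →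
    ⊢⟨ R ∧ᴿ (Not b ¹) ⟩ c₂ , c' ⟨ S ⟩ → ⊢⟨ R ⟩ (IF b THEN c₁ ELSE c₂) , c' ⟨ S ⟩
  whileFalseR : ∀ {R S b c c'} →
    ⊢⟨ R ∧ᴿ (Not b ¹) ⟩ SKIP , c' ⟨ S ⟩ → ⊢⟨ R ⟩ (WHILE b DO c) , c' ⟨ S ⟩
  whileTrueR : ∀ {R S b c c'} →
    ⊢⟨ R ∧ᴿ (b ¹) ⟩ (c ⨾ WHILE b DO c) , c' ⟨ S ⟩ → ⊢⟨ R ⟩ (WHILE b DO c) , c' ⟨ S ⟩
  backVarR : ∀ {R : ℕ → Rel} {S b c c'} →
    (∀ n → ⊢⟨ R n ∧ᴿ (b ¹) ⟩ c , SKIP ⟨ R (suc n) ⟩) →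
    ⊢⟨ ∃ᴿ R ⟩ (WHILE b DO c) , c' ⟨ S ⟩ →
    ⊢⟨ R 0 ⟩ (WHILE b DO c) , c' ⟨ S ⟩
  conseqR : ∀ {R₁ R₂ S₁ S₂ c c'} →
    R₁ ⟹ R₂ → ⊢⟨ R₁ ⟩ c , c' ⟨ S₁ ⟩ → S₂ ⟹ S₁ → ⊢⟨ R₂ ⟩ c , c' ⟨ S₂ ⟩
  disjR : ∀ {R₁ R₂ S₁ S₂ c c'} →
    ⊢⟨ R₁ ⟩ c , c' ⟨ S₁ ⟩ → ⊢⟨ R₂ ⟩ c , c' ⟨ S₂ ⟩ →
    ⊢⟨ R₁ ∨ᴿ R₂ ⟩ c , c' ⟨ S₁ ∨ᴿ S₂ ⟩
  symR : ∀ {R S c c'} →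
    ⊢⟨ flipᴿ R ⟩ c' , c ⟨ flipᴿ S ⟩ → ⊢⟨ R ⟩ c , c' ⟨ S ⟩

-- Each command d has a canonical relational postcondition, obtained by pushing
-- the first component of a relation forward through d with a predicate
-- transformer post d that over-approximates the strongest postcondition.  Two
-- facts make the rule derivable from Seq1 and Sym: the judgement
-- ⟨A⟩ d, skip ⟨post d A⟩ is derivable for every A (for loops by Back-Var, with
-- the iterates of the guarded body as the variant), and every derivable
-- ⟨S⟩ d, d' ⟨T⟩ is sound for it, T ⊆ post d' (post d S), by induction on the
-- derivation; Seq1 and Sym are handled by exchanging the two transformers, which
-- act on different components.  Now Seq1 gives ⟨R⟩ c;d, c' ⟨post d S⟩.  Reversed
-- by Sym, it composes by Seq1 with ⟨(post d S)⁻¹⟩ d', skip ⟨T⁻¹⟩, which is the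
-- derivable judgement for d' weakened by soundness of ⟨S⟩ d, d' ⟨T⟩; a final Sym
-- gives the rule.
module Submission where

open import Defs
open import Data.Nat using (ℕ; zero; suc; _+_)
open import Data.Nat.GeneralisedArithmetic using (iterate)
open import Data.Bool using (true; not)
open import Data.Product using (∃; _×_; _,_)
open import Data.Sum using (inj₁; inj₂; [_,_])
open import Function using (id)
open import Level using (Level; _⊔_; 0ℓ) renaming (suc to lsuc)
open import Relation.Binary.PropositionalEquality using (_≡_; refl; cong; sym; subst)
open import Relation.Unary using (Pred; _⊆_; _∩_; _∪_; ⋃)
open import Relation.Unary.PredicateTransformer using (Pt)

iterate-+ : ∀ {a} {A : Set a} (f : A → A) x m n →
            iterate f x (m + n) ≡ iterate f (iterate f x m) n
iterate-+ f x zero    n = refl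
iterate-+ f x (suc m) n = iterate-+ f (f x) m n

iterate-suc : ∀ {a} {A : Set a} (f : A → A) x n →
              f (iterate f x n) ≡ iterate f x (suc n)
iterate-suc f x zero    = refl
iterate-suc f x (suc n) = iterate-suc f (f x) n

module _ {a ℓ : Level} {A : Set a} where

  Monotone : Pt A ℓ → Set (a ⊔ lsuc ℓ)
  Monotone G = ∀ {P Q} → P ⊆ Q → G P ⊆ G Q

  Preserves-⋃ : Pt A ℓ → Set (a ⊔ lsuc ℓ)
  Preserves-⋃ G = ∀ (Q : ℕ → Pred A ℓ) → G (⋃ ℕ Q) ⊆ ⋃ ℕ (λ i → G (Q i))

  module _ {G : Pt A ℓ} (G-mono : Monotone G) where

    iterate-mono : ∀ n → Monotone (λ P → iterate G P n)
    iterate-mono zero    P⊆Q = P⊆Q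
    iterate-mono (suc n) P⊆Q = iterate-mono n (G-mono P⊆Q)

    iterate-⋃ : Preserves-⋃ G → ∀ n → Preserves-⋃ (λ P → iterate G P n)
    iterate-⋃ G-⋃ zero    Q p = p
    iterate-⋃ G-⋃ (suc n) Q p =
      iterate-⋃ G-⋃ n (λ i → G (Q i)) (iterate-mono n (G-⋃ Q) p)

    module _ (P : ℕ → Pred A ℓ) (P-step : ∀ n → P (suc n) ⊆ G (P n)) where

      chain⊆iterate : ∀ n → P n ⊆ iterate G (P 0) n
      chain⊆iterate zero    p = p
      chain⊆iterate (suc n) p =
        subst (λ X → X _) (iterate-suc G (P 0) n) (G-mono (chain⊆iterate n) (P-step n p))

      iterate-⋃-chain : Preserves-⋃ G →
                        ⋃ ℕ (iterate G (⋃ ℕ P)) ⊆ ⋃ ℕ (iterate G (P 0))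
      iterate-⋃-chain G-⋃ (m , p) with iterate-⋃ G-⋃ m P p
      ... | i , q = i + m , subst (λ X → X _) (sym (iterate-+ G (P 0) i m))
                                  (iterate-mono m (chain⊆iterate i) q)

holds : BExp → Pred State 0ℓ
holds b s = bval b s ≡ true

-- For an assignment both the backward form matching R[x:=e] and the forward
-- image are included: upd (upd s x v) x (s x) is only pointwise equal to s, so
-- neither contains the other without function extensionality.
mutual
  post : Com → Pt State 0ℓ
  post SKIP                   P = P
  post (x ::= e)              P = (λ t → ∃ λ v → P (upd t x v) × t x ≡ aval e (upd t x v))
                                ∪ (λ t → ∃ λ s → P s × ⟨ x ::= e , s ⟩⇒ t)
  post (c₁ ⨾ c₂)              P = post c₂ (post c₁ P)
  post (IF b THEN c₁ ELSE c₂) P = guardedPost b c₁ P ∪ guardedPost (Not b) c₂ P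
  post (WHILE b DO c)         P = ⋃ ℕ (iterate (guardedPost b c) P) ∩ holds (Not b)

  guardedPost : BExp → Com → Pt State 0ℓ
  guardedPost b c P = post c (P ∩ holds b)

mutual
  post-mono : ∀ c → Monotone (post c)
  post-mono SKIP                   h p                   = h p
  post-mono (x ::= e)              h (inj₁ (v , p , eq)) = inj₁ (v , h p , eq)
  post-mono (x ::= e)              h (inj₂ (s , p , ex)) = inj₂ (s , h p , ex)
  post-mono (c₁ ⨾ c₂)              h p                   = post-mono c₂ (post-mono c₁ h) p
  post-mono (IF b THEN c₁ ELSE c₂) h (inj₁ p)            = inj₁ (guardedPost-mono b c₁ h p)
  post-mono (IF b THEN c₁ ELSE c₂) h (inj₂ p)            =
    inj₂ (guardedPost-mono (Not b) c₂ h p)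
  post-mono (WHILE b DO c)         h ((n , p) , e)       =
    (n , iterate-mono (guardedPost-mono b c) n h p) , e

  guardedPost-mono : ∀ b c → Monotone (guardedPost b c)
  guardedPost-mono b c h = post-mono c (λ (p , e) → h p , e)

mutual
  post-⋃ : ∀ c → Preserves-⋃ (post c)
  post-⋃ SKIP                   Q p                           = p
  post-⋃ (x ::= e)              Q (inj₁ (v , (i , q) , eq))   = i , inj₁ (v , q , eq)
  post-⋃ (x ::= e)              Q (inj₂ (s , (i , q) , ex))   = i , inj₂ (s , q , ex)
  post-⋃ (c₁ ⨾ c₂)              Q p                           =
    post-⋃ c₂ (λ i → post c₁ (Q i)) (post-mono c₂ (post-⋃ c₁ Q) p)
  post-⋃ (IF b THEN c₁ ELSE c₂) Q (inj₁ p) with guardedPost-⋃ b c₁ Q p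
  ... | i , q = i , inj₁ q
  post-⋃ (IF b THEN c₁ ELSE c₂) Q (inj₂ p) with guardedPost-⋃ (Not b) c₂ Q p
  ... | i , q = i , inj₂ q
  post-⋃ (WHILE b DO c)         Q ((n , p) , e)
    with iterate-⋃ (guardedPost-mono b c) (guardedPost-⋃ b c) n Q p
  ... | i , q = i , (n , q) , e

  guardedPost-⋃ : ∀ b c → Preserves-⋃ (guardedPost b c)
  guardedPost-⋃ b c Q p =
    post-⋃ c (λ i → Q i ∩ holds b) (post-mono c (λ ((i , q) , e) → i , q , e) p)

-- A Fubini-style exchange: post c and post c' act on different coordinates of Q.
mutual
  post-swap : ∀ c c' (Q : Rel) {t t'} →
    post c (λ u → post c' (Q u) t') t → post c' (λ u' → post c (λ u → Q u u') t) t'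
  post-swap SKIP c' Q p = p
  post-swap (x ::= e) c' Q (inj₁ (v , p , eq)) = post-mono c' (λ q → inj₁ (v , q , eq)) p
  post-swap (x ::= e) c' Q (inj₂ (s , p , ex)) = post-mono c' (λ q → inj₂ (s , q , ex)) p
  post-swap (c₁ ⨾ c₂) c' Q p =
    post-swap c₂ c' (λ u u' → post c₁ (λ w → Q w u') u)
      (post-mono c₂ (post-swap c₁ c' Q) p)
  post-swap (IF b THEN c₁ ELSE c₂) c' Q (inj₁ p) =
    post-mono c' inj₁ (guardedPost-swap b c₁ c' Q p)
  post-swap (IF b THEN c₁ ELSE c₂) c' Q (inj₂ p) =
    post-mono c' inj₂ (guardedPost-swap (Not b) c₂ c' Q p)
  post-swap (WHILE b DO c) c' Q {t' = t'} ((n , p) , e) =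
    post-mono c' (λ q → (n , q) , e) (iterate-swap n Q p)
    where
    iterate-swap : ∀ n (Q : Rel) {t} →
      iterate (guardedPost b c) (λ u → post c' (Q u) t') n t →
      post c' (λ u' → iterate (guardedPost b c) (λ u → Q u u') n t) t'
    iterate-swap zero    Q p = p
    iterate-swap (suc n) Q p =
      iterate-swap n (λ u u' → guardedPost b c (λ w → Q w u') u)
        (iterate-mono (guardedPost-mono b c) n (guardedPost-swap b c c' Q) p)

  guardedPost-swap : ∀ b c c' (Q : Rel) {t t'} →
    guardedPost b c (λ u → post c' (Q u) t') t →
    post c' (λ u' → guardedPost b c (λ u → Q u u') t) t'
  guardedPost-swap b c c' Q p =
    post-swap c c' (λ u u' → Q u u' × holds b u)
      (post-mono c (λ (q , e) → post-mono c' (λ r → r , e) q) p)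

while-unroll : ∀ b c P → post (WHILE b DO c) (guardedPost b c P) ⊆ post (WHILE b DO c) P
while-unroll b c P ((n , p) , e) = (suc n , p) , e

post-exec : ∀ {c s t} (P : Pred State 0ℓ) → ⟨ c , s ⟩⇒ t → P s → post c P t
post-exec P Skip                         p = p
post-exec P Assign                       p = inj₂ (_ , p , Assign)
post-exec P (Seq e₁ e₂)                  p = post-exec _ e₂ (post-exec P e₁ p)
post-exec P (IfTrue bt e)                p = inj₁ (post-exec _ e (p , bt))
post-exec P (IfFalse bf e)               p = inj₂ (post-exec _ e (p , cong not bf))
post-exec P (WhileFalse bf)              p = (0 , p) , cong not bf
post-exec P (WhileTrue {b} {c} bt e₁ e₂) p =
  while-unroll b c P (post-exec (guardedPost b c P) e₂ (post-exec _ e₁ (p , bt)))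

postˡ : Com → Rel → Rel
postˡ c A t t' = post c (λ u → A u t') t

post₂ : Com → Com → Rel → Rel
post₂ c c' S t t' = post c' (postˡ c S t) t'

post₂-mono : ∀ c c' {S S'} → S ⟹ S' → post₂ c c' S ⟹ post₂ c c' S'
post₂-mono c c' h t t' = post-mono c' (λ {u'} → post-mono c (λ {u} → h u u'))

∨ᴿ-idem : ∀ {R} → (R ∨ᴿ R) ⟹ R
∨ᴿ-idem s s' = [ id , id ]

⊢-skip : ∀ {A} → ⊢⟨ A ⟩ SKIP , SKIP ⟨ A ⟩
⊢-skip = skipR (λ t t' a → t' , a , Skip)

post-derivable : ∀ (A : Rel) c → ⊢⟨ A ⟩ c , SKIP ⟨ postˡ c A ⟩
post-derivable A SKIP = ⊢-skip
post-derivable A (x ::= e) =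
  conseqR ∨ᴿ-idem
    (disjR (assignR ⊢-skip) (symR (skipR (λ t t' (s , a , ex) → s , a , ex))))
    (λ _ _ → id)
post-derivable A (c₁ ⨾ c₂) = seq1R (post-derivable A c₁) (post-derivable _ c₂)
post-derivable A (IF b THEN c₁ ELSE c₂) =
  conseqR ∨ᴿ-idem
    (disjR (ifTrueR (post-derivable _ c₁)) (ifFalseR (post-derivable _ c₂)))
    (λ _ _ → id)
post-derivable A (WHILE b DO c) = backVarR {R = Iter} Iter-step (whileFalseR ⊢-skip)
  where
  Iter : ℕ → Rel
  Iter n t t' = iterate (guardedPost b c) (λ u → A u t') n t

  Iter-step : ∀ n → ⊢⟨ Iter n ∧ᴿ (b ¹) ⟩ c , SKIP ⟨ Iter (suc n) ⟩
  Iter-step n = conseqR (λ _ _ → id) (post-derivable (Iter n ∧ᴿ (b ¹)) c)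
    (λ t t' → subst (λ X → X t) (sym (iterate-suc (guardedPost b c) (λ u → A u t') n)))

⊢-sound : ∀ {S T d d'} → ⊢⟨ S ⟩ d , d' ⟨ T ⟩ → T ⟹ post₂ d d' S
⊢-sound (skipR h) t t' x with h t t' x
... | s' , a , ex = post-exec _ ex a
⊢-sound {S} {d' = d'} (seq1R {c = d₁} {d = d₂} ⊢d₁ ⊢d₂) t t' x =
  post-swap d₂ d' (λ u u' → post d₁ (λ w → S w u') u)
    (post-mono d₂ (λ {u} → ⊢-sound ⊢d₁ u t') (⊢-sound ⊢d₂ t t' x))
⊢-sound {d' = d'} (assignR ⊢d) t t' x = post-mono d' inj₁ (⊢-sound ⊢d t t' x)
⊢-sound {d' = d'} (ifTrueR ⊢d) t t' x = post-mono d' inj₁ (⊢-sound ⊢d t t' x)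
⊢-sound {d' = d'} (ifFalseR ⊢d) t t' x = post-mono d' inj₂ (⊢-sound ⊢d t t' x)
⊢-sound {d' = d'} (whileFalseR ⊢d) t t' x =
  post-mono d' (λ (s , e) → (0 , s) , e) (⊢-sound ⊢d t t' x)
⊢-sound {S} {d = WHILE b DO c} {d' = d'} (whileTrueR ⊢d) t t' x =
  post-mono d' (λ {u'} → while-unroll b c (λ u → S u u')) (⊢-sound ⊢d t t' x)
⊢-sound {d = WHILE b DO c} {d' = d'} (backVarR {R = S} ⊢step ⊢d) t t' x =
  post-mono d' (λ {u'} ((m , p) , e) →
      iterate-⋃-chain (guardedPost-mono b c) (λ n u → S n u u')
        (λ n {u} → ⊢-sound (⊢step n) u u') (guardedPost-⋃ b c) (m , p) , e)
    (⊢-sound ⊢d t t' x)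
⊢-sound {d = d} {d' = d'} (conseqR R₁⟹R₂ ⊢d S₂⟹S₁) t t' x =
  post₂-mono d d' R₁⟹R₂ t t' (⊢-sound ⊢d t t' (S₂⟹S₁ t t' x))
⊢-sound {d = d} {d' = d'} (disjR ⊢d₁ ⊢d₂) t t' (inj₁ x) =
  post₂-mono d d' (λ _ _ → inj₁) t t' (⊢-sound ⊢d₁ t t' x)
⊢-sound {d = d} {d' = d'} (disjR ⊢d₁ ⊢d₂) t t' (inj₂ x) =
  post₂-mono d d' (λ _ _ → inj₂) t t' (⊢-sound ⊢d₂ t t' x)
⊢-sound {S} {d = d} {d' = d'} (symR ⊢d) t t' x = post-swap d d' S (⊢-sound ⊢d t' t x)

mainTheorem6 : (R S T : Rel) (c c' d d' : Com) →
    ⊢⟨ R ⟩ c , c' ⟨ S ⟩ → ⊢⟨ S ⟩ d , d' ⟨ T ⟩ →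
    ⊢⟨ R ⟩ (c ⨾ d) , (c' ⨾ d') ⟨ T ⟩
mainTheorem6 R S T c c' d d' ⊢c ⊢d =
  symR {R = R} {S = T} (seq1R ⊢c'-against-cd ⊢d'-against-skip)
  where
  M : Rel
  M = postˡ d S

  ⊢c'-against-cd : ⊢⟨ flipᴿ R ⟩ c' , c ⨾ d ⟨ flipᴿ M ⟩
  ⊢c'-against-cd = symR {R = flipᴿ R} {S = flipᴿ M} (seq1R ⊢c (post-derivable S d))

  ⊢d'-against-skip : ⊢⟨ flipᴿ M ⟩ d' , SKIP ⟨ flipᴿ T ⟩
  ⊢d'-against-skip =
    conseqR (λ _ _ → id) (post-derivable (flipᴿ M) d') (λ t t' → ⊢-sound ⊢d t' t)
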